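{- Let $A,B\subseteq\mathbb{N}$ be isobaric with respect to a simple partition of $\mathbb{N}$ with window length $L\in\mathbb{N}$, i.e. $|A\cap W_k|=|B\cap W_k|$ for all $k\in\mathbb{N}$, where $W_k=\{(k-1)L+1,\dots,kL\}$. Then $m(A)=m(B)$.
   Context: Conway's surreal numbers form an ordered field; $\omega=\{0,1,2,\dots\mid\ \}$ is the first infinite surreal number. An omnific integer is a surreal number $x$ with $x=\{x-1\mid x+1\}$; the surnatural numbers $\mathbf{Nn}$ are the omnific integers $\ge 0$. $\mathbb{N}=\{1,2,\dots\}\subseteq\mathbf{Nn}$, $\mathbb{N}_0=\mathbb{N}\cup\{0\}$, $\omega\in\mathbf{Nn}$, and $\omega/L\in\mathbf{Nn}$ for every $L\in\mathbb{N}$. For $A\subseteq\mathbb{N}$, $\kappa_A(n)=|A\cap\{1,\dots,n\}|$ is its counting sequence. Axiom of Extension (assumed throughout): every nondecreasing function $f:\mathbb{N}\to\mathbb{N}_0$ has an extension $\hat f:\mathbf{Nn}\to\mathbf{Nn}$ agreeing with $f$ on $\mathbb{N}$, such that for nondecreasing $f,g$: if $f(n)=g(n)$ for all sufficiently large $n$ then $\hat f(\nu)=\hat g(\nu)$ for all $\nu\in\mathbf{Nn}\setminus\mathbb{N}$; if $f(n)<g(n)$ for all sufficiently large $n$ then $\hat f(\nu)<\hat g(\nu)$ for all $\nu\in\mathbf{Nn}\setminus\mathbb{N}$; and $\widehat{f+g}=\hat f+\hat g$, $\widehat{f\cdot g}=\hat f\cdot\hat g$, $\widehat{f\circ g}=\hat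 f\circ\hat g$ (where defined); $n\mapsto Ln$ extends to $\nu\mapsto L\nu$. The magnum of $A\subseteq\mathbb{N}$ is $m(A):=\widehat{\kappa_A}(\omega)$. -}

module Defs where

open import Data.Nat using (ℕ; zero; suc; _+_; _*_; _∸_; _≤_; _<_; NonZero; z≤n; s≤s)
open import Data.Nat.Properties using (≤-trans; m≤m+n; ≤-refl; m≤n⇒m<n∨m≡n)
open import Data.Sum using (inj₁; inj₂)
open import Data.Bool using (Bool; true; false; if_then_else_)
open import Data.Product using (∃; _×_; _,_)
open import Relation.Binary.PropositionalEquality using (_≡_; _≢_; refl)
open import Relation.Nullary using (¬_)
open import Function using (_∘_)

-- A subset A ⊆ ℕ = {1,2,...} is given by its characteristic function;
-- only the values at n ≥ 1 are relevant.
Subset : Set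
Subset = ℕ → Bool

indicator : Bool → ℕ
indicator true  = 1
indicator false = 0

countRange : Subset → ℕ → ℕ → ℕ
countRange A a zero      = 0
countRange A a (suc len) = countRange A a len + indicator (A (a + suc len))

κ : Subset → ℕ → ℕ
κ A n = countRange A 0 n

windowCount : Subset → ℕ → ℕ → ℕ
windowCount A L k = countRange A ((k ∸ 1) * L) L

Isobaric : ℕ → Subset → Subset → Set
Isobaric L A B = ∀ k → 1 ≤ k → windowCount A L k ≡ windowCount B L k

-- Nondecreasing functions (domain extended to ℕ₀ with f 0 = value at 0).
Nondecreasing : (ℕ → ℕ) → Set
Nondecreasing f = ∀ {m n} → m ≤ n → f m ≤ f n

κ-mono : (A : Subset) → Nondecreasing (κ A)
κ-mono A {m} {n} m≤n = go m n m≤n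
  where
  go : ∀ m n → m ≤ n → κ A m ≤ κ A n
  go m zero    z≤n = ≤-refl
  go m (suc n) p with m≤n⇒m<n∨m≡n p
  ... | inj₂ refl = ≤-refl
  ... | inj₁ (s≤s q) = ≤-trans (go m n q) (m≤m+n (κ A n) (indicator (A (0 + suc n))))

-- Abstract interface to the surnatural numbers Nn ⊆ No together with the
-- Axiom of Extension, exactly as listed in the paper's standing assumptions.
record SurnaturalsWithExtension : Set₁ where
  infixl 6 _⊕_
  infixl 7 _⊗_
  field
    Nn   : Set
    ι    : ℕ → Nn
    _≺_  : Nn → Nn → Set
    _⊕_  : Nn → Nn → Nn
    _⊗_  : Nn → Nn → Nn
    ω    : Nn
    ω-infinite : ∀ n → ω ≢ ι n
    ω/   : (L : ℕ) → .{{NonZero L}} → Nn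
    ω/-spec : (L : ℕ) → .{{_ : NonZero L}} → ι L ⊗ ω/ L ≡ ω
    ext  : (f : ℕ → ℕ) → Nondecreasing f → Nn → Nn
    ext-agree : ∀ f (p : Nondecreasing f) n → 1 ≤ n → ext f p (ι n) ≡ ι (f n)
    ext-eq : ∀ f g (p : Nondecreasing f) (q : Nondecreasing g) →
             (∃ λ N → ∀ n → N ≤ n → f n ≡ g n) →
             ∀ ν → (∀ n → ν ≢ ι n) → ext f p ν ≡ ext g q ν
    ext-lt : ∀ f g (p : Nondecreasing f) (q : Nondecreasing g) →
             (∃ λ N → ∀ n → N ≤ n → f n < g n) →
             ∀ ν → (∀ n → ν ≢ ι n) → ext f p ν ≺ ext g q ν
    ext-+ : ∀ f g (p : Nondecreasing f) (q : Nondecreasing g)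
              (r : Nondecreasing (λ n → f n + g n)) ν →
            ext (λ n → f n + g n) r ν ≡ ext f p ν ⊕ ext g q ν
    ext-* : ∀ f g (p : Nondecreasing f) (q : Nondecreasing g)
              (r : Nondecreasing (λ n → f n * g n)) ν →
            ext (λ n → f n * g n) r ν ≡ ext f p ν ⊗ ext g q ν
    ext-∘ : ∀ f g (p : Nondecreasing f) (q : Nondecreasing g)
              (r : Nondecreasing (f ∘ g)) ν →
            ext (f ∘ g) r ν ≡ ext f p (ext g q ν)
    ext-scale : ∀ L (p : Nondecreasing (λ n → L * n)) ν →
                ext (λ n → L * n) p ν ≡ ι L ⊗ ν

  magnum : Subset → Nn
  magnum A = ext (κ A) (κ-mono A) ω

{-# OPTIONS --safe #-}
-- Isobaric sets have the same number of elements below every multiple of L,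
-- so κ_A ∘ (L ·_) = κ_B ∘ (L ·_). Since ω = L · (ω/L), the Axiom of Extension
-- gives m(A) = κ̂_A(L · ω/L) = (κ_A ∘ (L ·_))^(ω/L), and likewise for B; the two
-- extensions agree at ω/L because ω/L is not a natural number.
module Submission where

open import Defs
open import Data.Nat using (ℕ; NonZero; zero; suc; _+_; _*_; s≤s; z≤n)
open import Data.Nat.Properties using (+-suc; +-assoc; +-comm; +-identityʳ; *-comm; *-monoʳ-≤; ≤-refl)
open import Data.Product using (_,_)
open import Function using (_∘_)
open import Relation.Binary.PropositionalEquality

countRange-+ : ∀ A a m len →
               countRange A a (m + len) ≡ countRange A a m + countRange A (a + m) len
countRange-+ A a m zero rewrite +-identityʳ m | +-identityʳ (countRange A a m) = refl
countRange-+ A a m (suc len) = begin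
    countRange A a (m + suc len)
  ≡⟨ cong (countRange A a) (+-suc m len) ⟩
    countRange A a (m + len) + indicator (A (a + suc (m + len)))
  ≡⟨ cong₂ _+_ (countRange-+ A a m len) (cong (indicator ∘ A) shift) ⟩
    countRange A a m + countRange A (a + m) len + indicator (A (a + m + suc len))
  ≡⟨ +-assoc (countRange A a m) _ _ ⟩
    countRange A a m + countRange A (a + m) (suc len) ∎
  where
  open ≡-Reasoning
  shift : a + suc (m + len) ≡ a + m + suc len
  shift = trans (cong (a +_) (sym (+-suc m len))) (sym (+-assoc a m (suc len)))

κ-*-isobaric : ∀ L A B → Isobaric L A B → ∀ n → κ A (n * L) ≡ κ B (n * L)
κ-*-isobaric L A B iso zero = refl
κ-*-isobaric L A B iso (suc n) = begin
    κ A (L + n * L)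
  ≡⟨ cong (κ A) (+-comm L (n * L)) ⟩
    κ A (n * L + L)
  ≡⟨ countRange-+ A 0 (n * L) L ⟩
    κ A (n * L) + windowCount A L (suc n)
  ≡⟨ cong₂ _+_ (κ-*-isobaric L A B iso n) (iso (suc n) (s≤s z≤n)) ⟩
    κ B (n * L) + windowCount B L (suc n)
  ≡⟨ sym (countRange-+ B 0 (n * L) L) ⟩
    κ B (n * L + L)
  ≡⟨ cong (κ B) (+-comm (n * L) L) ⟩
    κ B (L + n * L) ∎
  where open ≡-Reasoning

κ-L*-isobaric : ∀ L A B → Isobaric L A B → ∀ n → κ A (L * n) ≡ κ B (L * n)
κ-L*-isobaric L A B iso n rewrite *-comm L n = κ-*-isobaric L A B iso n

module _ (S : SurnaturalsWithExtension) (L : ℕ) .{{_ : NonZero L}} where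
  open SurnaturalsWithExtension S

  *-mono : Nondecreasing (L *_)
  *-mono = *-monoʳ-≤ L

  ∘*-mono : (f : ℕ → ℕ) → Nondecreasing f → Nondecreasing (f ∘ (L *_))
  ∘*-mono f f-mono = f-mono ∘ *-mono

  const-mono : ∀ n → Nondecreasing (λ (_ : ℕ) → n)
  const-mono n _ = ≤-refl

  ι-⊗ : ∀ n → ι L ⊗ ι n ≡ ι (L * n)
  ι-⊗ n = begin
      ι L ⊗ ι n
    ≡⟨ cong (ι L ⊗_) (sym (ext-agree (λ _ → n) (const-mono n) 1 (s≤s z≤n))) ⟩
      ι L ⊗ ext (λ _ → n) (const-mono n) (ι 1)
    ≡⟨ sym (ext-scale L *-mono _) ⟩
      ext (L *_) *-mono (ext (λ _ → n) (const-mono n) (ι 1))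
    ≡⟨ sym (ext-∘ (L *_) (λ _ → n) *-mono (const-mono n) (const-mono (L * n)) (ι 1)) ⟩
      ext (λ _ → L * n) (const-mono (L * n)) (ι 1)
    ≡⟨ ext-agree _ (const-mono (L * n)) 1 (s≤s z≤n) ⟩
      ι (L * n) ∎
    where open ≡-Reasoning

  ω/-infinite : ∀ n → ω/ L ≢ ι n
  ω/-infinite n ω/L≡n = ω-infinite (L * n)
    (trans (sym (ω/-spec L)) (trans (cong (ι L ⊗_) ω/L≡n) (ι-⊗ n)))

  ext-at-ω : ∀ f (f-mono : Nondecreasing f) →
             ext f f-mono ω ≡ ext (f ∘ (L *_)) (∘*-mono f f-mono) (ω/ L)
  ext-at-ω f f-mono = begin
      ext f f-mono ω
    ≡⟨ cong (ext f f-mono) (sym (ω/-spec L)) ⟩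
      ext f f-mono (ι L ⊗ ω/ L)
    ≡⟨ cong (ext f f-mono) (sym (ext-scale L *-mono (ω/ L))) ⟩
      ext f f-mono (ext (L *_) *-mono (ω/ L))
    ≡⟨ sym (ext-∘ f (L *_) f-mono *-mono (∘*-mono f f-mono) (ω/ L)) ⟩
      ext (f ∘ (L *_)) (∘*-mono f f-mono) (ω/ L) ∎
    where open ≡-Reasoning

theorem14 : (S : SurnaturalsWithExtension) (L : ℕ) .{{_ : NonZero L}} (A B : Subset) →
    Isobaric L A B → SurnaturalsWithExtension.magnum S A ≡ SurnaturalsWithExtension.magnum S B
theorem14 S L A B iso = begin
    magnum A
  ≡⟨ ext-at-ω S L (κ A) (κ-mono A) ⟩
    ext (κ A ∘ (L *_)) (∘*-mono S L (κ A) (κ-mono A)) (ω/ L)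
  ≡⟨ ext-eq _ _ _ _ (0 , λ n _ → κ-L*-isobaric L A B iso n) (ω/ L) (ω/-infinite S L) ⟩
    ext (κ B ∘ (L *_)) (∘*-mono S L (κ B) (κ-mono B)) (ω/ L)
  ≡⟨ sym (ext-at-ω S L (κ B) (κ-mono B)) ⟩
    magnum B ∎
  where
  open SurnaturalsWithExtension S
  open ≡-Reasoning
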